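{- Let $\Phi_e(G, n, m)$ be a $\Delta_0$ formula with free variables $n, m$ and set parameter $G$, and let $p, q \in \mathbb{Q}_1$ with $q \leq p$. (a) If $p \Vdash (\exists n)(\forall m)\Phi_e(G, n, m)$ then $q \Vdash (\exists n)(\forall m)\Phi_e(G, n, m)$. (b) If $p \Vdash (\forall n)(\exists m)\neg \Phi_e(G, n, m)$ then $q \Vdash (\forall n)(\exists m)\neg \Phi_e(G, n, m)$.
   Context: A binary string $\sigma$ is identified with the finite set $F_\sigma = \{x < |\sigma| : \sigma(x) = 1\}$; for strings, $\sigma \subseteq \tau$, $\sigma \cup \rho$, $\tau - \sigma$ refer to these finite sets, $\rho \subseteq X$ (for a set $X$) means $F_\rho \subseteq X$, and $\sigma \preceq \tau$ is the prefix relation; $\Phi_e(\sigma, n, m)$ means the formula evaluated with $G = F_\sigma$. Fix an effective enumeration $\mathcal{U}_0, \mathcal{U}_1, \dots$ of all $\Sigma^0_1$ classes in $2^\omega$ that are upward closed under $\supseteq$. A largeness class is a class $\mathcal{A} \subseteq 2^\omega$ upward closed under $\supseteq$ such that for every $k$-cover $Y_0 \cup \dots \cup Y_{k-1} \supseteq \omega$ some $Y_j \in \mathcal{A}$. Let $\zeta$ be the computable function such that for an index $e$ of a $\Delta_0$ formula $\Phi_e(G,n,m)$, a string $\sigma$ and $n \in \omega$, $\mathcal{U}_{\zeta(e,\sigma,n)} = \{X : (\exists \rho \subseteq X - \{0,\dots,|\sigma|\})(\exists m)\neg\Phi_e(\sigma \cup \rho, n, m)\}$. $\mathbb{Q}_1$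 is the set of tuples $(\sigma, X, C, U)$ with $\sigma$ a binary string and $X, C, U \subseteq \omega$ such that $X \cap \{0, \dots, |\sigma|\} = \emptyset$, $U \subseteq X$, $\bigcap_{e \in C}\mathcal{U}_e$ is a largeness class containing only infinite sets, and $U \in \bigcap_{e \in C}\mathcal{U}_e$. The order: $(\tau, Y, D, V) \leq (\sigma, X, C, U)$ iff $\sigma \preceq \tau$, $Y \subseteq X$, $V \subseteq U$, $C \subseteq D$ and $\tau - \sigma \subseteq U$. For $p = (\sigma, X, C, U) \in \mathbb{Q}_1$: $p \Vdash (\exists n)(\forall m)\Phi_e(G,n,m)$ iff there is $n$ such that for every string $\tau \subseteq X$ and every $m$, $\Phi_e(\sigma \cup \tau, n, m)$ holds; $p \Vdash (\forall n)(\exists m)\neg\Phi_e(G,n,m)$ iff for every string $\rho \subseteq U$ and every $n$, $\zeta(e, \sigma \cup \rho, n) \in C$. -}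

module Defs where

open import Data.Nat using (ℕ; zero; suc; _+_; _*_; _≤_; _<_; _≡ᵇ_; _<ᵇ_)
open import Data.Bool using (Bool; true; false; _∧_; _∨_; not)
open import Data.List using (List; []; _∷_; length; _++_)
open import Data.Fin using (Fin)
open import Data.Product using (Σ; _×_; ∃; _,_)
open import Relation.Binary.PropositionalEquality using (_≡_)
open import Relation.Nullary using (¬_)

Set2ω : Set
Set2ω = ℕ → Bool

_⊆ω_ : Set2ω → Set2ω → Set
X ⊆ω Y = ∀ x → X x ≡ true → Y x ≡ true

Class : Set₁
Class = Set2ω → Set

UpwardClosed : Class → Set
UpwardClosed 𝒜 = ∀ X Y → 𝒜 X → X ⊆ω Y → 𝒜 Y

Infinite : Set2ω → Set
Infinite X = ∀ n → Σ ℕ (λ m → n ≤ m × X m ≡ true)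

IsLargeness : Class → Set
IsLargeness 𝒜 =
  UpwardClosed 𝒜 ×
  (∀ (k : ℕ) (Y : Fin k → Set2ω) →
     (∀ x → Σ (Fin k) (λ j → Y j x ≡ true)) →
     Σ (Fin k) (λ j → 𝒜 (Y j)))

-- Binary strings, identified with finite sets F_σ

Str : Set
Str = List Bool

bit : Str → ℕ → Bool
bit [] _ = false
bit (b ∷ σ) zero = b
bit (b ∷ σ) (suc x) = bit σ x

F : Str → Set2ω
F = bit

_∪s_ : Str → Str → Str
[] ∪s ρ = ρ
(a ∷ σ) ∪s [] = a ∷ σ
(a ∷ σ) ∪s (b ∷ ρ) = (a ∨ b) ∷ (σ ∪s ρ)

_∖s_ : Str → Str → Str
[] ∖s σ = []
(a ∷ τ) ∖s [] = a ∷ τ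
(a ∷ τ) ∖s (b ∷ σ) = (a ∧ not b) ∷ (τ ∖s σ)

_⊆s_ : Str → Set2ω → Set
ρ ⊆s X = F ρ ⊆ω X

_⊆s_minus≤_ : Str → Set2ω → ℕ → Set
ρ ⊆s X minus≤ ℓ = ∀ x → bit ρ x ≡ true → X x ≡ true × ℓ < x

_⪯_ : Str → Str → Set
σ ⪯ τ = Σ Str (λ ρ → σ ++ ρ ≡ τ)

-- Δ₀ formulas with a set parameter G (syntax, de Bruijn variables)

data Term : Set where
  var  : ℕ → Term
  zro  : Term
  sc   : Term → Term
  _⊕_  : Term → Term → Term
  _⊗_  : Term → Term → Term

data Δ₀ : Set where
  _≐_   : Term → Term → Δ₀
  _≺_   : Term → Term → Δ₀
  memG  : Term → Δ₀
  neg   : Δ₀ → Δ₀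
  _∧'_  : Δ₀ → Δ₀ → Δ₀
  _∨'_  : Δ₀ → Δ₀ → Δ₀
  all<  : Term → Δ₀ → Δ₀            -- (∀ x < t) φ   (x = var 0 in φ)
  ex<   : Term → Δ₀ → Δ₀

Env : Set
Env = ℕ → ℕ

_∷ₑ_ : ℕ → Env → Env
(a ∷ₑ ρ) zero = a
(a ∷ₑ ρ) (suc i) = ρ i

evalT : Env → Term → ℕ
evalT ρ (var i) = ρ i
evalT ρ zro = 0
evalT ρ (sc t) = suc (evalT ρ t)
evalT ρ (t ⊕ s) = evalT ρ t + evalT ρ s
evalT ρ (t ⊗ s) = evalT ρ t * evalT ρ s

mutual
  evalF : Set2ω → Env → Δ₀ → Bool
  evalF G ρ (t ≐ s) = evalT ρ t ≡ᵇ evalT ρ s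
  evalF G ρ (t ≺ s) = evalT ρ t <ᵇ evalT ρ s
  evalF G ρ (memG t) = G (evalT ρ t)
  evalF G ρ (neg φ) = not (evalF G ρ φ)
  evalF G ρ (φ ∧' ψ) = evalF G ρ φ ∧ evalF G ρ ψ
  evalF G ρ (φ ∨' ψ) = evalF G ρ φ ∨ evalF G ρ ψ
  evalF G ρ (all< t φ) = allBelow G ρ φ (evalT ρ t)
  evalF G ρ (ex< t φ) = exBelow G ρ φ (evalT ρ t)

  allBelow : Set2ω → Env → Δ₀ → ℕ → Bool
  allBelow G ρ φ zero = true
  allBelow G ρ φ (suc k) = allBelow G ρ φ k ∧ evalF G (k ∷ₑ ρ) φ

  exBelow : Set2ω → Env → Δ₀ → ℕ → Bool
  exBelow G ρ φ zero = false
  exBelow G ρ φ (suc k) = exBelow G ρ φ k ∨ evalF G (k ∷ₑ ρ) φ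

Holds : Δ₀ → Set2ω → ℕ → ℕ → Set
Holds φ G n m = evalF G (n ∷ₑ (m ∷ₑ (λ _ → 0))) φ ≡ true

HoldsS : Δ₀ → Str → ℕ → ℕ → Set
HoldsS φ σ n m = Holds φ (F σ) n m

module Setting (𝒰 : ℕ → Class) (Φ : ℕ → Δ₀) (ζ : ℕ → Str → ℕ → ℕ) where

  ⋂𝒰 : Set2ω → Class
  ⋂𝒰 C X = ∀ e → C e ≡ true → 𝒰 e X

  ZetaSpec : Set
  ZetaSpec = ∀ e σ n X →
    (𝒰 (ζ e σ n) X → Σ Str (λ ρ → ρ ⊆s X minus≤ length σ ×
                         Σ ℕ (λ m → ¬ HoldsS (Φ e) (σ ∪s ρ) n m)))
    × (Σ Str (λ ρ → ρ ⊆s X minus≤ length σ ×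
                 Σ ℕ (λ m → ¬ HoldsS (Φ e) (σ ∪s ρ) n m)) → 𝒰 (ζ e σ n) X)

  record Q₁ : Set₁ where
    constructor cond
    field
      σ : Str
      X : Set2ω
      C : Set2ω
      U : Set2ω
      X-disj : ∀ x → x ≤ length σ → X x ≡ false
      U⊆X    : U ⊆ω X
      large  : IsLargeness (⋂𝒰 C)
      onlyInf : ∀ Z → ⋂𝒰 C Z → Infinite Z
      U∈     : ⋂𝒰 C U

  _≤Q_ : Q₁ → Q₁ → Set
  q ≤Q p = σ p ⪯ σ q × X q ⊆ω X p × U q ⊆ω U p × C p ⊆ω C q
           × ((σ q ∖s σ p) ⊆s U p)
    where open Q₁

  ForcesΣ₂ : Q₁ → ℕ → Set
  ForcesΣ₂ p e = Σ ℕ (λ n → ∀ (τ : Str) → τ ⊆s Q₁.X p → ∀ m →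
                   HoldsS (Φ e) (Q₁.σ p ∪s τ) n m)

  ForcesΠ₂ : Q₁ → ℕ → Set
  ForcesΠ₂ p e = ∀ (ρ : Str) → ρ ⊆s Q₁.U p → ∀ n →
                   Q₁.C p (ζ e (Q₁.σ p ∪s ρ) n) ≡ true

-- Extending a condition only adds bits that already lie in U p ⊆ X p, so every
-- extension of σ q by a string inside X q (resp. U q) is an extension of σ p by
-- a string inside X p (resp. U p): the Σ₂-witness n for p serves for q, and the
-- codes ζ e (σ q ∪ ρ) n lie in C p ⊆ C q.

module Submission where

open import Defs
open import Data.Nat using (ℕ; zero; suc)
open import Data.Bool using (true; false; not)
open import Data.Bool.Properties using (∨-assoc; ∨-abs-∧)
open import Data.List using ([]; _∷_; _++_)
open import Data.Product using (_×_; _,_)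
open import Data.Sum using (_⊎_; inj₁; inj₂; [_,_])
open import Relation.Binary.PropositionalEquality using (_≡_; refl; cong; cong₂; subst; module ≡-Reasoning)

⊆ω-trans : ∀ {X Y Z} → X ⊆ω Y → Y ⊆ω Z → X ⊆ω Z
⊆ω-trans X⊆Y Y⊆Z x x∈X = Y⊆Z x (X⊆Y x x∈X)

∪s-assoc : ∀ σ τ ρ → (σ ∪s τ) ∪s ρ ≡ σ ∪s (τ ∪s ρ)
∪s-assoc []      τ       ρ       = refl
∪s-assoc (a ∷ σ) []      ρ       = refl
∪s-assoc (a ∷ σ) (b ∷ τ) []      = refl
∪s-assoc (a ∷ σ) (b ∷ τ) (c ∷ ρ) = cong₂ _∷_ (∨-assoc a b c) (∪s-assoc σ τ ρ)

∪s-∖s-++ : ∀ σ ρ → σ ∪s ((σ ++ ρ) ∖s σ) ≡ σ ++ ρ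
∪s-∖s-++ []      []      = refl
∪s-∖s-++ []      (b ∷ ρ) = refl
∪s-∖s-++ (a ∷ σ) ρ       = cong₂ _∷_ (∨-abs-∧ a (not a)) (∪s-∖s-++ σ ρ)

∪s-∖s-prefix : ∀ {σ τ} → σ ⪯ τ → σ ∪s (τ ∖s σ) ≡ τ
∪s-∖s-prefix {σ} (ρ , refl) = ∪s-∖s-++ σ ρ

bit-∪s : ∀ σ τ x → bit (σ ∪s τ) x ≡ true → bit σ x ≡ true ⊎ bit τ x ≡ true
bit-∪s []          τ       x       h = inj₂ h
bit-∪s (a ∷ σ)     []      x       h = inj₁ h
bit-∪s (true ∷ σ)  (b ∷ τ) zero    h = inj₁ refl
bit-∪s (false ∷ σ) (b ∷ τ) zero    h = inj₂ h
bit-∪s (a ∷ σ)     (b ∷ τ) (suc x) h = bit-∪s σ τ x h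

∪s-⊆s : ∀ σ τ {X} → σ ⊆s X → τ ⊆s X → (σ ∪s τ) ⊆s X
∪s-⊆s σ τ σ⊆X τ⊆X x h = [ σ⊆X x , τ⊆X x ] (bit-∪s σ τ x h)

∪s-via-prefix : ∀ {σ τ} → σ ⪯ τ → ∀ ρ → σ ∪s ((τ ∖s σ) ∪s ρ) ≡ τ ∪s ρ
∪s-via-prefix {σ} {τ} σ⪯τ ρ = begin
  σ ∪s ((τ ∖s σ) ∪s ρ) ≡⟨ ∪s-assoc σ (τ ∖s σ) ρ ⟨
  (σ ∪s (τ ∖s σ)) ∪s ρ ≡⟨ cong (_∪s ρ) (∪s-∖s-prefix σ⪯τ) ⟩
  τ ∪s ρ               ∎
  where open ≡-Reasoning

lemma2p25 : (𝒰 : ℕ → Class) (Φ : ℕ → Δ₀) (ζ : ℕ → Str → ℕ → ℕ) →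
    (∀ e → UpwardClosed (𝒰 e)) →
    Setting.ZetaSpec 𝒰 Φ ζ →
    ∀ (e : ℕ) (p q : Setting.Q₁ 𝒰 Φ ζ) → Setting._≤Q_ 𝒰 Φ ζ q p →
    (Setting.ForcesΣ₂ 𝒰 Φ ζ p e → Setting.ForcesΣ₂ 𝒰 Φ ζ q e)
    × (Setting.ForcesΠ₂ 𝒰 Φ ζ p e → Setting.ForcesΠ₂ 𝒰 Φ ζ q e)
lemma2p25 𝒰 Φ ζ _ _ e p q (σp⪯σq , Xq⊆Xp , Uq⊆Up , Cp⊆Cq , new⊆Up) = forcesΣ₂ , forcesΠ₂
  where
    open Setting 𝒰 Φ ζ
    open Q₁

    added : Str
    added = σ q ∖s σ p

    via-p : ∀ ρ → σ p ∪s (added ∪s ρ) ≡ σ q ∪s ρ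
    via-p = ∪s-via-prefix σp⪯σq

    forcesΣ₂ : ForcesΣ₂ p e → ForcesΣ₂ q e
    forcesΣ₂ (n , holds) = n , λ τ τ⊆Xq m →
      subst (λ s → HoldsS (Φ e) s n m) (via-p τ)
        (holds (added ∪s τ) (∪s-⊆s added τ (⊆ω-trans new⊆Up (U⊆X p)) (⊆ω-trans τ⊆Xq Xq⊆Xp)) m)

    forcesΠ₂ : ForcesΠ₂ p e → ForcesΠ₂ q e
    forcesΠ₂ inC ρ ρ⊆Uq n = Cp⊆Cq _
      (subst (λ s → C p (ζ e s n) ≡ true) (via-p ρ)
        (inC (added ∪s ρ) (∪s-⊆s added ρ new⊆Up (⊆ω-trans ρ⊆Uq Uq⊆Up)) n))
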